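{- There are infinitely many pairwise non-isomorphic minimal non-matching tournaments.
   Context: A tournament has exactly one directed edge between any two distinct vertices. For an ordering of the vertex set, a backedge is an edge from a later vertex to an earlier one; a matching ordering is one in which every vertex is an end of at most one backedge, and a matching tournament is a tournament with at least one matching ordering. A minimal non-matching tournament is a tournament $G$ that is not a matching tournament but every subtournament of $G$ with fewer than $|V(G)|$ vertices is a matching tournament. -}

module Defs where

open import Data.Nat using (ℕ; _<_)
open import Data.Fin using (Fin)
open import Data.Fin.Permutation using (Permutation; Permutation′; _⟨$⟩ʳ_)
open import Data.Product using (Σ; _×_; _,_)
open import Data.Sum using (_⊎_)
open import Relation.Binary.PropositionalEquality using (_≡_; _≢_)
open import Relation.Nullary using (¬_)
open import Function.Definitions using (Injective)

record Tournament (n : ℕ) : Set₁ where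
  field
    E          : Fin n → Fin n → Set
    irrefl     : ∀ u → ¬ E u u
    total      : ∀ u v → u ≢ v → E u v ⊎ E v u
    asym       : ∀ u v → E u v → ¬ E v u
open Tournament public

-- An ordering of the vertex set: a bijection assigning each vertex its position.
Ordering : ℕ → Set
Ordering n = Permutation′ n

pos : ∀ {n} → Ordering n → Fin n → Fin n
pos σ v = σ ⟨$⟩ʳ v

Backedge : ∀ {n} → Tournament n → Ordering n → Fin n → Fin n → Set
Backedge T σ u v = E T u v × (Data.Fin._<_ (pos σ v) (pos σ u))

IsEnd : ∀ {n} → Fin n → Fin n → Fin n → Set
IsEnd x u v = (x ≡ u) ⊎ (x ≡ v)

MatchingOrdering : ∀ {n} → Tournament n → Ordering n → Set
MatchingOrdering T σ =
  ∀ x u v u′ v′ → Backedge T σ u v → Backedge T σ u′ v′ →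
    IsEnd x u v → IsEnd x u′ v′ → (u ≡ u′) × (v ≡ v′)

MatchingTournament : ∀ {n} → Tournament n → Set
MatchingTournament {n} T = Σ (Ordering n) (λ σ → MatchingOrdering T σ)

induced : ∀ {m n} (T : Tournament n) (f : Fin m → Fin n) → Injective _≡_ _≡_ f → Tournament m
induced T f inj = record
  { E      = λ u v → E T (f u) (f v)
  ; irrefl = λ u → irrefl T (f u)
  ; total  = λ u v u≢v → total T (f u) (f v) (λ eq → u≢v (inj eq))
  ; asym   = λ u v → asym T (f u) (f v)
  }

MinimalNonMatching : ∀ {n} → Tournament n → Set
MinimalNonMatching {n} T =
  ¬ MatchingTournament T ×
  (∀ m (f : Fin m → Fin n) (inj : Injective _≡_ _≡_ f) → m < n →
     MatchingTournament (induced T f inj))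

Isomorphic : ∀ {m n} → Tournament m → Tournament n → Set
Isomorphic {m} {n} T U =
  Σ (Permutation m n) (λ φ → ∀ u v → (E T u v → E U (φ ⟨$⟩ʳ u) (φ ⟨$⟩ʳ v)) ×
                                     (E U (φ ⟨$⟩ʳ u) (φ ⟨$⟩ʳ v) → E T u v))

SomeTournament : Set₁
SomeTournament = Σ ℕ Tournament

module Submission where

-- For c ≥ 1, tournament c is the transitive tournament on 0, …, 2c+4 with the arcs between 2m and 2m+3
-- (m < c), 2c and 2c+2, 2c+2 and 2c+4, and 1 and 2c+3 reversed.
--
-- It has no matching ordering: by induction on i ≤ 2c, the vertex in position i must be i, since
-- any later vertex placed there would receive two backedges. Then 2c+2 is already matched with 2c
-- and 2c+3 with 1, yet the triangle 2c+2 → 2c+3 → 2c+4 → 2c+2 has a backedge at 2c+2 or 2c+3.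
--
-- After deleting any vertex d there is a matching ordering: for a parameter s, move each 2r with
-- s ≤ r < c to just after 2r+3 and 2c (if s ≤ c) to just after 2c+2. The backedges are then pairwise
-- disjoint except for a single path of length two, and s can be chosen so that this path runs
-- through d. The orders 2c+5 distinguish the tournaments up to isomorphism.

open import Defs
open import Data.Nat using (ℕ; zero; suc; _+_; _≤_; _<_; z≤n; s≤s; s≤s⁻¹; _≟_; _≤?_; _<?_)
open import Data.Nat.Properties
open import Data.Fin as Fin using (Fin; toℕ; fromℕ<; punchOut)
import Data.Fin.Properties as Finₚ
open import Data.Fin.Subset using (Subset; inside; outside; _∈_; ∣_∣)
open import Data.Fin.Subset.Properties using (p⊂q⇒∣p∣<∣q∣; ∣⊤∣≡n; ∈⊤)
open import Data.Fin.Permutation using (Permutation′; permutation; _⟨$⟩ʳ_; _⟨$⟩ˡ_; inverseˡ; inverseʳ; refute)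
open import Data.Vec using ([]; _∷_; here; there)
open import Data.Product as Prod using (Σ; ∃; ∃₂; _×_; _,_; proj₁; proj₂)
open import Data.Sum as Sum using (_⊎_; inj₁; inj₂)
open import Data.Empty using (⊥; ⊥-elim)
open import Function using (_∘_)
open import Function.Definitions using (Injective)
open import Relation.Nullary using (¬_; Dec; yes; no; contradiction; ¬?)
open import Relation.Nullary.Decidable using (decidable-stable; map′; _×-dec_; _⊎-dec_)
open import Relation.Binary using (tri<; tri≈; tri>)
open import Relation.Binary.PropositionalEquality using (_≡_; _≢_; refl; sym; trans; cong; subst; subst₂; module ≡-Reasoning)

pos-injective : ∀ {n} (σ : Ordering n) → Injective _≡_ _≡_ (pos σ)
pos-injective σ {u} {v} eq = begin
  u                  ≡⟨ inverseˡ σ ⟨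
  σ ⟨$⟩ˡ (σ ⟨$⟩ʳ u)  ≡⟨ cong (σ ⟨$⟩ˡ_) eq ⟩
  σ ⟨$⟩ˡ (σ ⟨$⟩ʳ v)  ≡⟨ inverseˡ σ ⟩
  v                  ∎
  where open ≡-Reasoning

injective⇒surjective : ∀ {m} {f : Fin m → Fin m} → Injective _≡_ _≡_ f → ∀ j → ∃ λ i → f i ≡ j
injective⇒surjective {suc m} {f} f-injective j with Finₚ.any? (λ i → f i Fin.≟ j)
... | yes hit   = hit
... | no missed = contradiction (Finₚ.injective⇒≤ punchOut∘f-injective) 1+n≰n
  where
  j≢f : ∀ i → j ≢ f i
  j≢f i eq = missed (i , sym eq)

  punchOut∘f-injective : Injective _≡_ _≡_ (λ i → punchOut (j≢f i))
  punchOut∘f-injective eq = f-injective (Finₚ.punchOut-injective (j≢f _) (j≢f _) eq)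

injective⇒permutation : ∀ {m} {f : Fin m → Fin m} → Injective _≡_ _≡_ f →
                        Σ (Permutation′ m) λ π → ∀ u → π ⟨$⟩ʳ u ≡ f u
injective⇒permutation {m} {f} f-injective =
  permutation f (proj₁ ∘ preimage) (proj₂ ∘ preimage) (λ u → f-injective (proj₂ (preimage (f u)))) ,
  λ _ → refl
  where
  preimage : ∀ j → ∃ λ i → f i ≡ j
  preimage = injective⇒surjective f-injective

injective⇒missing : ∀ {m n} {f : Fin m → Fin n} → Injective _≡_ _≡_ f → m < n →
                    ∃ λ d → ∀ u → f u ≢ d
injective⇒missing {f = f} f-injective m<n with Finₚ.any? (λ d → ¬? (Finₚ.any? (λ u → f u Fin.≟ d)))
... | yes (d , unhit) = d , λ u eq → unhit (u , eq)
... | no allHit       = contradiction (Finₚ.injective⇒≤ preimage-injective) (<⇒≱ m<n)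
  where
  preimage : ∀ d → ∃ λ u → f u ≡ d
  preimage d = decidable-stable (Finₚ.any? (λ u → f u Fin.≟ d)) (λ unhit → allHit (d , unhit))

  preimage-injective : Injective _≡_ _≡_ (proj₁ ∘ preimage)
  preimage-injective {x} {y} eq = trans (sym (proj₂ (preimage x))) (trans (cong f eq) (proj₂ (preimage y)))

below : ∀ {m} → (Fin m → ℕ) → ℕ → Subset m
below {zero}  κ k = []
below {suc m} κ k with κ Fin.zero <? k
... | yes _ = inside  ∷ below (κ ∘ Fin.suc) k
... | no  _ = outside ∷ below (κ ∘ Fin.suc) k

∈-below : ∀ {m} {κ : Fin m → ℕ} {k} w → κ w < k → w ∈ below κ k
∈-below {suc m} {κ} {k} Fin.zero κw<k with κ Fin.zero <? k
... | yes _   = here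
... | no  κ≮k = contradiction κw<k κ≮k
∈-below {suc m} {κ} {k} (Fin.suc w) κw<k with κ Fin.zero <? k
... | yes _ = there (∈-below w κw<k)
... | no  _ = there (∈-below w κw<k)

below-∈ : ∀ {m} {κ : Fin m → ℕ} {k} w → w ∈ below κ k → κ w < k
below-∈ {suc m} {κ} {k} Fin.zero w∈ with κ Fin.zero <? k | w∈
... | yes κw<k | _ = κw<k
below-∈ {suc m} {κ} {k} (Fin.suc w) w∈ with κ Fin.zero <? k | w∈
... | yes _ | there w∈′ = below-∈ w w∈′
... | no  _ | there w∈′ = below-∈ w w∈′

module _ {m} (κ : Fin m → ℕ) (κ-injective : Injective _≡_ _≡_ κ) where

  private
    rank : Fin m → ℕ
    rank u = ∣ below κ (κ u) ∣

    rank-mono : ∀ {u v} → κ u < κ v → rank u < rank v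
    rank-mono {u} κu<κv = p⊂q⇒∣p∣<∣q∣
      ((λ {w} w∈ → ∈-below w (<-trans (below-∈ w w∈) κu<κv)) ,
       u , ∈-below u κu<κv , λ u∈ → <-irrefl refl (below-∈ u u∈))

    rank<m : ∀ u → rank u < m
    rank<m u = subst (rank u <_) (∣⊤∣≡n m)
      (p⊂q⇒∣p∣<∣q∣ ((λ _ → ∈⊤) , u , ∈⊤ , λ u∈ → <-irrefl refl (below-∈ u u∈)))

    rank-injective : ∀ {u v} → rank u ≡ rank v → u ≡ v
    rank-injective {u} {v} eq with <-cmp (κ u) (κ v)
    ... | tri< κu<κv _ _ = contradiction eq (<⇒≢ (rank-mono κu<κv))
    ... | tri≈ _ κu≡κv _ = κ-injective κu≡κv
    ... | tri> _ _ κv<κu = contradiction (sym eq) (<⇒≢ (rank-mono κv<κu))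

    rank-reflects : ∀ {u v} → rank u < rank v → κ u < κ v
    rank-reflects {u} {v} lt with <-cmp (κ u) (κ v)
    ... | tri< κu<κv _ _ = κu<κv
    ... | tri≈ _ κu≡κv _ = contradiction (cong rank (κ-injective κu≡κv)) (<⇒≢ lt)
    ... | tri> _ _ κv<κu = contradiction (rank-mono κv<κu) (<⇒≯ lt)

    ranking : Σ (Permutation′ m) λ π → ∀ u → π ⟨$⟩ʳ u ≡ fromℕ< (rank<m u)
    ranking = injective⇒permutation λ {u} {v} eq →
      rank-injective (trans (sym (Finₚ.toℕ-fromℕ< (rank<m u))) (trans (cong toℕ eq) (Finₚ.toℕ-fromℕ< (rank<m v))))

    toℕ-pos : ∀ u → toℕ (pos (proj₁ ranking) u) ≡ rank u
    toℕ-pos u = trans (cong toℕ (proj₂ ranking u)) (Finₚ.toℕ-fromℕ< (rank<m u))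

  orderingBy : Σ (Ordering m) λ σ → ∀ u v → pos σ v Fin.< pos σ u → κ v < κ u
  orderingBy = proj₁ ranking , λ u v lt → rank-reflects (subst₂ _<_ (toℕ-pos v) (toℕ-pos u) lt)

module _ {n} (T : Tournament n) (σ : Ordering n) where

  Touch : Fin n → Fin n → Set
  Touch x y = Backedge T σ x y ⊎ Backedge T σ y x

  matching⇒partner-unique : MatchingOrdering T σ → ∀ {x y y′} → Touch x y → Touch x y′ → y ≡ y′
  matching⇒partner-unique matching {x} {y} {y′} (inj₁ b) (inj₁ b′) =
    proj₂ (matching x x y x y′ b b′ (inj₁ refl) (inj₁ refl))
  matching⇒partner-unique matching {x} {y} {y′} (inj₁ b) (inj₂ b′) =
    let x≡y′ , y≡x = matching x x y y′ x b b′ (inj₁ refl) (inj₂ refl) in trans y≡x x≡y′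
  matching⇒partner-unique matching {x} {y} {y′} (inj₂ b) (inj₁ b′) =
    let y≡x , x≡y′ = matching x y x x y′ b b′ (inj₂ refl) (inj₁ refl) in trans y≡x x≡y′
  matching⇒partner-unique matching {x} {y} {y′} (inj₂ b) (inj₂ b′) =
    proj₁ (matching x y x y′ x b b′ (inj₂ refl) (inj₂ refl))

  triangle⇒backedge : ∀ {x y z} → E T x y → E T y z → E T z x →
                      Backedge T σ x y ⊎ Backedge T σ y z ⊎ Backedge T σ z x
  triangle⇒backedge {x} {y} {z} xy yz zx with Finₚ.<-cmp (pos σ x) (pos σ y)
  ... | tri> _ _ y<x = inj₁ (xy , y<x)
  ... | tri≈ _ x≈y _ = ⊥-elim (irrefl T y (subst (λ v → E T v y) (pos-injective σ x≈y) xy))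
  ... | tri< x<y _ _ with Finₚ.<-cmp (pos σ y) (pos σ z)
  ...   | tri> _ _ z<y = inj₂ (inj₁ (yz , z<y))
  ...   | tri≈ _ y≈z _ = ⊥-elim (irrefl T z (subst (λ v → E T v z) (pos-injective σ y≈z) yz))
  ...   | tri< y<z _ _ = inj₂ (inj₂ (zx , Finₚ.<-trans x<y y<z))

IsMatching : {X : Set} → (X → X → Set) → Set
IsMatching R = ∀ {x a b a′ b′} → R a b → R a′ b′ → x ≡ a ⊎ x ≡ b → x ≡ a′ ⊎ x ≡ b′ → a ≡ a′ × b ≡ b′

matchingOrdering-via : ∀ {X : Set} {n} {T : Tournament n} {σ : Ordering n} {R : X → X → Set}
                       (A : Fin n → X) → Injective _≡_ _≡_ A → IsMatching R →
                       (∀ {u v} → Backedge T σ u v → R (A u) (A v)) → MatchingOrdering T σ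
matchingOrdering-via A A-injective R-matching backedge⇒R x u v u′ v′ b b′ end end′ =
  Prod.map A-injective A-injective
    (R-matching (backedge⇒R b) (backedge⇒R b′) (Sum.map (cong A) (cong A) end) (Sum.map (cong A) (cong A) end′))

-- The transitive tournament a → b (a < b), with the arc between each pair j > i related by R turned around.
Arc : (ℕ → ℕ → Set) → ℕ → ℕ → Set
Arc R a b = (a < b × ¬ R b a) ⊎ (b < a × R a b)

Arc-irreflexive : ∀ {R a} → ¬ Arc R a a
Arc-irreflexive (inj₁ (a<a , _)) = <-irrefl refl a<a
Arc-irreflexive (inj₂ (a<a , _)) = <-irrefl refl a<a

Arc-asymmetric : ∀ {R a b} → Arc R a b → ¬ Arc R b a
Arc-asymmetric (inj₁ (a<b , _))  (inj₁ (b<a , _))  = <-asym a<b b<a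
Arc-asymmetric (inj₁ (_ , ¬Rba)) (inj₂ (_ , Rba))  = ¬Rba Rba
Arc-asymmetric (inj₂ (_ , Rab))  (inj₁ (_ , ¬Rab)) = ¬Rab Rab
Arc-asymmetric (inj₂ (b<a , _))  (inj₂ (a<b , _))  = <-asym a<b b<a

Arc-total : ∀ {R} → (∀ j i → Dec (R j i)) → ∀ a b → a ≢ b → Arc R a b ⊎ Arc R b a
Arc-total R? a b a≢b with <-cmp a b
... | tri≈ _ a≡b _ = contradiction a≡b a≢b
... | tri< a<b _ _ with R? b a
...   | yes Rba = inj₂ (inj₂ (a<b , Rba))
...   | no ¬Rba = inj₁ (inj₁ (a<b , ¬Rba))
Arc-total R? a b a≢b | tri> _ _ b<a with R? a b
...   | yes Rab = inj₁ (inj₂ (b<a , Rab))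
...   | no ¬Rab = inj₂ (inj₁ (b<a , ¬Rab))

reversalTournament : ∀ {R} → (∀ j i → Dec (R j i)) → ∀ n → Tournament n
reversalTournament {R} R? n = record
  { E      = λ u v → Arc R (toℕ u) (toℕ v)
  ; irrefl = λ _ → Arc-irreflexive {R}
  ; total  = λ u v u≢v → Arc-total R? (toℕ u) (toℕ v) (u≢v ∘ Finₚ.toℕ-injective)
  ; asym   = λ _ _ → Arc-asymmetric {R}
  }

double : ℕ → ℕ
double zero    = zero
double (suc n) = suc (suc (double n))

double-injective : Injective _≡_ _≡_ double
double-injective {zero}  {zero}  _  = refl
double-injective {suc m} {suc n} eq = cong suc (double-injective (suc-injective (suc-injective eq)))

double≢odd : ∀ m n → double m ≢ suc (double n)
double≢odd (suc m) (suc n) eq = double≢odd m n (suc-injective (suc-injective eq))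

double-+ : ∀ m n → double (m + n) ≡ double m + double n
double-+ zero    n = refl
double-+ (suc m) n = cong (suc ∘ suc) (double-+ m n)

double-mono-≤ : ∀ {m n} → m ≤ n → double m ≤ double n
double-mono-≤ z≤n       = z≤n
double-mono-≤ (s≤s m≤n) = s≤s (s≤s (double-mono-≤ m≤n))

double-mono-< : ∀ {m n} → m < n → double m < double n
double-mono-< {zero}  {suc n} _         = s≤s z≤n
double-mono-< {suc m} {suc n} (s≤s m<n) = s≤s (s≤s (double-mono-< m<n))

double≤1+double⇒≤ : ∀ {m n} → double m ≤ suc (double n) → m ≤ n
double≤1+double⇒≤ {zero}                        _ = z≤n
double≤1+double⇒≤ {suc m} {suc n} (s≤s (s≤s le)) = s≤s (double≤1+double⇒≤ le)

even-injective : ∀ {a x y} → a ≡ double x → a ≡ double y → x ≡ y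
even-injective p q = double-injective (trans (sym p) q)

odd-injective : ∀ {a x y} → a ≡ suc (double x) → a ≡ suc (double y) → x ≡ y
odd-injective p q = double-injective (suc-injective (trans (sym p) q))

even-odd : ∀ {a x y} → a ≡ double x → a ≡ suc (double y) → ⊥
even-odd p q = double≢odd _ _ (trans (sym p) q)

odd-even : ∀ {a x y} → a ≡ suc (double x) → a ≡ double y → ⊥
odd-even p q = even-odd q p

data EvenOdd : ℕ → Set where
  even : ∀ r → EvenOdd (double r)
  odd  : ∀ r → EvenOdd (suc (double r))

evenOdd : ∀ a → EvenOdd a
evenOdd zero = even 0
evenOdd (suc a) with evenOdd a
... | even r = odd r
... | odd  r = even (suc r)

evenOdd-double : ∀ r → evenOdd (double r) ≡ even r
evenOdd-double zero    = refl
evenOdd-double (suc r) rewrite evenOdd-double r = refl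

evenOdd-odd : ∀ r → evenOdd (suc (double r)) ≡ odd r
evenOdd-odd r rewrite evenOdd-double r = refl

data Reversed (c j i : ℕ) : Set where
  rung : ∀ m → m < c → j ≡ 3 + double m → i ≡ double m → Reversed c j i
  top₁ : j ≡ 2 + double c → i ≡ double c → Reversed c j i
  top₂ : j ≡ 4 + double c → i ≡ 2 + double c → Reversed c j i
  long : j ≡ 3 + double c → i ≡ 1 → Reversed c j i

reversed? : ∀ c j i → Dec (Reversed c j i)
reversed? c j i = map′ fromSum toSum
  (anyUpTo? (λ m → (j ≟ 3 + double m) ×-dec (i ≟ double m)) c
   ⊎-dec (j ≟ 2 + double c) ×-dec (i ≟ double c)
   ⊎-dec (j ≟ 4 + double c) ×-dec (i ≟ 2 + double c)
   ⊎-dec (j ≟ 3 + double c) ×-dec (i ≟ 1))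
  where
  fromSum : _ → Reversed c j i
  fromSum (inj₁ (m , m<c , p , q))     = rung m m<c p q
  fromSum (inj₂ (inj₁ (p , q)))        = top₁ p q
  fromSum (inj₂ (inj₂ (inj₁ (p , q)))) = top₂ p q
  fromSum (inj₂ (inj₂ (inj₂ (p , q)))) = long p q

  toSum : Reversed c j i → _
  toSum (rung m m<c p q) = inj₁ (m , m<c , p , q)
  toSum (top₁ p q)       = inj₂ (inj₁ (p , q))
  toSum (top₂ p q)       = inj₂ (inj₂ (inj₁ (p , q)))
  toSum (long p q)       = inj₂ (inj₂ (inj₂ (p , q)))

order : ℕ → ℕ
order c = 5 + double c

order-injective : Injective _≡_ _≡_ order
order-injective eq = double-injective (+-cancelˡ-≡ 5 _ _ eq)

tournament : ∀ c → Tournament (order c)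
tournament c = reversalTournament (reversed? c) (order c)

Reversed-gap : ∀ {c j i} → Reversed c j i → 2 + i ≤ j
Reversed-gap (rung m _ refl refl) = n≤1+n _
Reversed-gap (top₁ refl refl)     = ≤-refl
Reversed-gap (top₂ refl refl)     = ≤-refl
Reversed-gap (long refl refl)     = s≤s (s≤s (s≤s z≤n))

Reversed-< : ∀ {c j i} → Reversed c j i → i < j
Reversed-< r = ≤-trans (n≤1+n _) (Reversed-gap r)

Reversed-bound : ∀ {c j i} → Reversed c j i → j < order c
Reversed-bound     (rung m m<c refl _) = s≤s (s≤s (s≤s (≤-trans (double-mono-< m<c) (m≤n+m _ 2))))
Reversed-bound {c} (top₁ refl _)       = s≤s (s≤s (s≤s (m≤n+m (double c) 2)))
Reversed-bound     (top₂ refl _)       = ≤-refl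
Reversed-bound {c} (long refl _)       = s≤s (s≤s (s≤s (s≤s (n≤1+n (double c)))))

Reversed-functional : ∀ {c j i i′} → Reversed c j i → Reversed c j i′ → i ≡ i′
Reversed-functional (rung _ _ p q) (rung _ _ p′ q′) = trans q (trans (cong double (suc-injective (odd-injective p p′))) (sym q′))
Reversed-functional (rung _ _ p _) (top₁ p′ _)      = ⊥-elim (odd-even p p′)
Reversed-functional (rung _ _ p _) (top₂ p′ _)      = ⊥-elim (odd-even p p′)
Reversed-functional (rung _ m<c p _) (long p′ _)    = ⊥-elim (<-irrefl (suc-injective (odd-injective p p′)) m<c)
Reversed-functional (top₁ p _) (rung _ _ p′ _)      = ⊥-elim (even-odd p p′)
Reversed-functional (top₁ _ q) (top₁ _ q′)          = trans q (sym q′)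
Reversed-functional (top₁ p _) (top₂ p′ _)          = ⊥-elim (1+n≢n (sym (even-injective p p′)))
Reversed-functional (top₁ p _) (long p′ _)          = ⊥-elim (even-odd p p′)
Reversed-functional (top₂ p _) (rung _ _ p′ _)      = ⊥-elim (even-odd p p′)
Reversed-functional (top₂ p _) (top₁ p′ _)          = ⊥-elim (1+n≢n (even-injective p p′))
Reversed-functional (top₂ _ q) (top₂ _ q′)          = trans q (sym q′)
Reversed-functional (top₂ p _) (long p′ _)          = ⊥-elim (even-odd p p′)
Reversed-functional (long p _) (rung _ m<c p′ _)    = ⊥-elim (<-irrefl (suc-injective (odd-injective p′ p)) m<c)
Reversed-functional (long p _) (top₁ p′ _)          = ⊥-elim (odd-even p p′)
Reversed-functional (long p _) (top₂ p′ _)          = ⊥-elim (odd-even p p′)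
Reversed-functional (long _ q) (long _ q′)          = trans q (sym q′)

Reversed-gap-two : ∀ {c i} → Reversed c (2 + i) i → i ≤ double c → i ≡ double c
Reversed-gap-two (rung _ _ p q)  _    = ⊥-elim (1+n≢n (trans (sym p) (cong (2 +_) q)))
Reversed-gap-two (top₁ _ q)      _    = q
Reversed-gap-two (top₂ _ refl)   i≤2c = ⊥-elim (1+n≰n (≤-trans (n≤1+n _) i≤2c))
Reversed-gap-two (long p refl)   1≤2c = ⊥-elim (1+n≰n (subst (1 ≤_) (sym (suc-injective (suc-injective (suc-injective p)))) 1≤2c))

Reversed-at-low-vertex : ∀ {c} i → i ≤ double c →
                         (∃ λ j → Reversed c j (suc i)) ⊎ (∃ λ y → y < i × Reversed c (suc i) y)
Reversed-at-low-vertex {c} i i≤2c with evenOdd i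
... | even zero    = inj₁ (3 + double c , long refl refl)
... | even (suc m) = inj₂ (double m , n≤1+n _ , rung m (double≤1+double⇒≤ (m≤n⇒m≤1+n i≤2c)) refl refl)
... | odd r with m≤n⇒m<n∨m≡n (double≤1+double⇒≤ (s≤s i≤2c))
...   | inj₁ 1+r<c = inj₁ (_ , rung (suc r) 1+r<c refl refl)
...   | inj₂ refl  = inj₁ (_ , top₁ refl refl)

-- No matching ordering

-- Forced c i w x: in an ordering that places 0, …, i−1 first and w at position i,
-- the arc between x and w is a backedge.
data Forced (c i w x : ℕ) : Set where
  into   : x < order c → i ≤ x → Arc (Reversed c) x w → Forced c i w x
  out-of : x < order c → x < i → Arc (Reversed c) w x → Forced c i w x

forward-forced : ∀ {c i w x} → w < order c → i ≤ x → x < w → ¬ Reversed c w x → Forced c i w x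
forward-forced w<n i≤x x<w ¬r = into (<-trans x<w w<n) i≤x (inj₁ (x<w , ¬r))

reversed-forced : ∀ {c i w x} → i ≤ w → Reversed c x w → Forced c i w x
reversed-forced i≤w r = into (Reversed-bound r) (≤-trans i≤w (<⇒≤ (Reversed-< r))) (inj₂ (Reversed-< r , r))

forced-twice : ∀ {c i w} → i ≤ double c → i < w → w < order c →
               ∃₂ λ x x′ → x ≢ x′ × Forced c i w x × Forced c i w x′
forced-twice {c} {i} {w} i≤2c i<w w<n with m≤n⇒m<n∨m≡n i<w
... | inj₂ refl with Reversed-at-low-vertex i i≤2c
...   | inj₁ (j , r) =
  i , j , <⇒≢ (<-trans i<w (Reversed-< r)) ,
  forward-forced w<n ≤-refl i<w (λ r′ → 1+n≰n (Reversed-gap r′)) ,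
  reversed-forced (<⇒≤ i<w) r
...   | inj₂ (y , y<i , r) =
  i , y , (λ i≡y → <-irrefl (sym i≡y) y<i) ,
  forward-forced w<n ≤-refl i<w (λ r′ → 1+n≰n (Reversed-gap r′)) ,
  out-of (<-trans (<-trans y<i i<w) w<n) y<i (inj₂ (<-trans y<i i<w , r))
forced-twice {c} {i} {w} i≤2c i<w w<n | inj₁ i+1<w with reversed? c w i
... | yes r with m≤n⇒m<n∨m≡n i+1<w
...   | inj₁ i+2<w =
  suc i , 2 + i , 1+n≢n ∘ sym ,
  forward-forced w<n (n≤1+n i) i+1<w (λ r′ → 1+n≢n (sym (Reversed-functional r r′))) ,
  forward-forced w<n (m≤n+m i 2) i+2<w (λ r′ → m≢1+n+m i {1} (Reversed-functional r r′))
...   | inj₂ refl with Reversed-gap-two r i≤2c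
...     | refl =
  suc (double c) , 4 + double c , m≢1+n+m (suc (double c)) {2} ,
  forward-forced w<n (n≤1+n _) i+1<w (λ r′ → 1+n≢n (sym (Reversed-functional r r′))) ,
  reversed-forced (m≤n+m _ 2) (top₂ refl refl)
forced-twice {c} {i} {w} i≤2c i<w w<n | inj₁ i+1<w | no ¬r with reversed? c w (suc i)
... | no ¬r′ =
  i , suc i , 1+n≢n ∘ sym ,
  forward-forced w<n ≤-refl i<w ¬r ,
  forward-forced w<n (n≤1+n i) i+1<w ¬r′
... | yes r′ =
  i , 2 + i , m≢1+n+m i {1} ,
  forward-forced w<n ≤-refl i<w ¬r ,
  forward-forced w<n (m≤n+m i 2) (Reversed-gap r′) (λ r″ → 1+n≢n (sym (Reversed-functional r′ r″)))

module NotMatching {c} {σ : Ordering (order c)} (matching : MatchingOrdering (tournament c) σ) where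

  private
    T : Tournament (order c)
    T = tournament c

    position : Fin (order c) → ℕ
    position v = toℕ (pos σ v)

    vertex : ∀ {a} → a < order c → Fin (order c)
    vertex a<n = fromℕ< a<n

    toℕ-vertex : ∀ {a} (a<n : a < order c) → toℕ (vertex a<n) ≡ a
    toℕ-vertex a<n = Finₚ.toℕ-fromℕ< a<n

    vertex-injective : ∀ {a b} (a<n : a < order c) (b<n : b < order c) → vertex a<n ≡ vertex b<n → a ≡ b
    vertex-injective a<n b<n eq = trans (sym (toℕ-vertex a<n)) (trans (cong toℕ eq) (toℕ-vertex b<n))

    arc-into : ∀ {a} (a<n : a < order c) {v} → Arc (Reversed c) a (toℕ v) → E T (vertex a<n) v
    arc-into a<n = subst (λ x → Arc (Reversed c) x _) (sym (toℕ-vertex a<n))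

    arc-from : ∀ {a} (a<n : a < order c) {v} → Arc (Reversed c) (toℕ v) a → E T v (vertex a<n)
    arc-from a<n = subst (Arc (Reversed c) _) (sym (toℕ-vertex a<n))

    arc : ∀ {a b} (a<n : a < order c) (b<n : b < order c) → Arc (Reversed c) a b → E T (vertex a<n) (vertex b<n)
    arc a<n b<n = subst₂ (Arc (Reversed c)) (sym (toℕ-vertex a<n)) (sym (toℕ-vertex b<n))

    partner-unique : ∀ {x y y′} → Touch T σ x y → Touch T σ x y′ → y ≡ y′
    partner-unique = matching⇒partner-unique T σ matching

  FixedBelow : ℕ → Set
  FixedBelow i = ∀ v → toℕ v < i → position v ≡ toℕ v

  fixed⇒late : ∀ {i} → FixedBelow i → ∀ {v} → i ≤ toℕ v → i ≤ position v
  fixed⇒late {i} fixed {v} i≤v with i ≤? position v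
  ... | yes i≤pv = i≤pv
  ... | no  i≰pv = contradiction (subst (_< i) pv≡v (≰⇒> i≰pv)) (≤⇒≯ i≤v)
    where
    pv<n : position v < order c
    pv<n = Finₚ.toℕ<n (pos σ v)

    u≡v : vertex pv<n ≡ v
    u≡v = pos-injective σ (Finₚ.toℕ-injective
            (trans (fixed _ (subst (_< i) (sym (toℕ-vertex pv<n)) (≰⇒> i≰pv))) (toℕ-vertex pv<n)))

    pv≡v : position v ≡ toℕ v
    pv≡v = trans (sym (toℕ-vertex pv<n)) (cong toℕ u≡v)

  backedge-to-fixed : ∀ {i y} → FixedBelow i → (y<n : y < order c) → y < i →
                      ∀ {w} → i ≤ position w → E T w (vertex y<n) → Backedge T σ w (vertex y<n)
  backedge-to-fixed {i} {y} fixed y<n y<i i≤pw e = e , <-≤-trans (subst (_< i) (sym y-fixed) y<i) i≤pw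
    where
    y-fixed : position (vertex y<n) ≡ y
    y-fixed = trans (fixed _ (subst (_< i) (sym (toℕ-vertex y<n)) y<i)) (toℕ-vertex y<n)

  backedge-from-late : ∀ {i} → FixedBelow i → ∀ {w} → position w ≡ i →
                       ∀ {x} → i ≤ toℕ x → E T x w → Backedge T σ x w
  backedge-from-late fixed {w} pw≡i {x} i≤x e =
    e , ≤∧≢⇒< (subst (_≤ position x) (sym pw≡i) (fixed⇒late fixed i≤x)) pw≢px
    where
    pw≢px : position w ≢ position x
    pw≢px eq = irrefl T x (subst (E T x) (pos-injective σ (Finₚ.toℕ-injective eq)) e)

  Forced-bound : ∀ {i w x} → Forced c i w x → x < order c
  Forced-bound (into x<n _ _)   = x<n
  Forced-bound (out-of x<n _ _) = x<n

  forced⇒touch : ∀ {i} → FixedBelow i → ∀ {w} → position w ≡ i →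
                 ∀ {x} (f : Forced c i (toℕ w) x) → Touch T σ w (vertex (Forced-bound f))
  forced⇒touch fixed pw≡i (into x<n i≤x a) =
    inj₂ (backedge-from-late fixed pw≡i (subst (_ ≤_) (sym (toℕ-vertex x<n)) i≤x) (arc-into x<n a))
  forced⇒touch fixed pw≡i (out-of x<n x<i a) =
    inj₁ (backedge-to-fixed fixed x<n x<i (≤-reflexive (sym pw≡i)) (arc-from x<n a))

  fixed-step : ∀ {i} → i ≤ double c → FixedBelow i → FixedBelow (suc i)
  fixed-step {i} i≤2c fixed v v≤i with m≤n⇒m<n∨m≡n (s≤s⁻¹ v≤i)
  ... | inj₁ v<i = fixed v v<i
  ... | inj₂ v≡i = trans (cong position (Finₚ.toℕ-injective (trans v≡i (sym w≡i)))) (trans pw≡i (sym v≡i))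
    where
    i<n : i < order c
    i<n = s≤s (≤-trans i≤2c (m≤n+m _ 4))

    w : Fin (order c)
    w = σ ⟨$⟩ˡ vertex i<n

    pw≡i : position w ≡ i
    pw≡i = trans (cong toℕ (inverseʳ σ)) (toℕ-vertex i<n)

    w≡i : toℕ w ≡ i
    w≡i with <-cmp (toℕ w) i
    ... | tri< w<i _ _ = contradiction (trans (sym pw≡i) (fixed w w<i)) (<⇒≢ w<i ∘ sym)
    ... | tri≈ _ eq _  = eq
    ... | tri> _ _ i<w =
      let x , x′ , x≢x′ , f , f′ = forced-twice i≤2c i<w (Finₚ.toℕ<n w)
      in  contradiction (vertex-injective (Forced-bound f) (Forced-bound f′)
                           (partner-unique (forced⇒touch fixed pw≡i f) (forced⇒touch fixed pw≡i f′)))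
                        x≢x′

  fixed-upto : ∀ i → i ≤ suc (double c) → FixedBelow i
  fixed-upto zero    _   _ ()
  fixed-upto (suc i) i<n = fixed-step (s≤s⁻¹ i<n) (fixed-upto i (m≤n⇒m≤1+n (s≤s⁻¹ i<n)))

  private
    fixed : FixedBelow (suc (double c))
    fixed = fixed-upto (suc (double c)) ≤-refl

    2c<n : double c < order c
    2c<n = s≤s (m≤n+m (double c) 4)

    1<n : 1 < order c
    1<n = s≤s (s≤s z≤n)

    X<n : 2 + double c < order c
    X<n = s≤s (s≤s (s≤s (m≤n+m (double c) 2)))

    Y<n : 3 + double c < order c
    Y<n = s≤s (s≤s (s≤s (s≤s (n≤1+n (double c)))))

    Z<n : 4 + double c < order c
    Z<n = ≤-refl

    consecutive-arc : ∀ {a} → Arc (Reversed c) a (suc a)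
    consecutive-arc = inj₁ (≤-refl , λ r → 1+n≰n (Reversed-gap r))

    late : ∀ {a} (a<n : a < order c) → suc (double c) ≤ a → suc (double c) ≤ position (vertex a<n)
    late a<n le = fixed⇒late fixed (subst (_ ≤_) (sym (toℕ-vertex a<n)) le)

    X~2c : Touch T σ (vertex X<n) (vertex 2c<n)
    X~2c = inj₁ (backedge-to-fixed fixed 2c<n ≤-refl (late X<n (n≤1+n _))
                   (arc X<n 2c<n (inj₂ (n≤1+n _ , top₁ refl refl))))

    Y~1 : 1 ≤ double c → Touch T σ (vertex Y<n) (vertex 1<n)
    Y~1 1≤2c = inj₁ (backedge-to-fixed fixed 1<n (s≤s 1≤2c) (late Y<n (m≤n+m _ 2))
                       (arc Y<n 1<n (inj₂ (s≤s (s≤s z≤n) , long refl refl))))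

  impossible : 1 ≤ double c → ⊥
  impossible 1≤2c with triangle⇒backedge T σ (arc X<n Y<n consecutive-arc) (arc Y<n Z<n consecutive-arc)
                                             (arc Z<n X<n (inj₂ (n≤1+n _ , top₂ refl refl)))
  ... | inj₁ XY        = m≢1+n+m (double c) {2} (sym (vertex-injective Y<n 2c<n (partner-unique (inj₁ XY) X~2c)))
  ... | inj₂ (inj₁ YZ) = contradiction (suc-injective (vertex-injective Z<n 1<n (partner-unique (inj₁ YZ) (Y~1 1≤2c)))) λ ()
  ... | inj₂ (inj₂ ZX) = m≢1+n+m (double c) {3} (sym (vertex-injective Z<n 2c<n (partner-unique (inj₂ ZX) X~2c)))

tournament-not-matching : ∀ c → ¬ MatchingTournament (tournament (suc c))
tournament-not-matching c (σ , matching) = NotMatching.impossible {suc c} {σ} matching (s≤s z≤n)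

-- Matching orderings after deleting a vertex

bonus : ℕ → ℕ → ℕ → ℕ
bonus c s r with s ≤? r | r <? c | r ≟ c
... | yes _ | yes _ | _     = 13
... | yes _ | no _  | yes _ = 9
... | _     | _     | _     = 0

bonus-cases : ∀ c s r → bonus c s r ≡ 0 ⊎ (s ≤ r × r < c × bonus c s r ≡ 13) ⊎ (s ≤ r × r ≡ c × bonus c s r ≡ 9)
bonus-cases c s r with s ≤? r | r <? c | r ≟ c
... | yes s≤r | yes r<c | _       = inj₂ (inj₁ (s≤r , r<c , refl))
... | yes s≤r | no _    | yes r≡c = inj₂ (inj₂ (s≤r , r≡c , refl))
... | yes _   | no _    | no _    = inj₁ refl
... | no _    | _       | _       = inj₁ refl

bonus-rung : ∀ {c s r} → s ≤ r → r < c → bonus c s r ≡ 13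
bonus-rung {c} {s} {r} s≤r r<c with s ≤? r | r <? c
... | yes _  | yes _  = refl
... | no s≰r | _      = contradiction s≤r s≰r
... | yes _  | no r≮c = contradiction r<c r≮c

bonus-top : ∀ {c s} → s ≤ c → bonus c s c ≡ 9
bonus-top {c} {s} s≤c with s ≤? c | c <? c | c ≟ c
... | no s≰c | _       | _      = contradiction s≤c s≰c
... | yes _  | yes c<c | _      = contradiction c<c (<-irrefl refl)
... | yes _  | no _    | yes _  = refl
... | yes _  | no _    | no c≢c = contradiction refl c≢c

bonus-high : ∀ {c s r} → c < r → bonus c s r ≡ 0
bonus-high {c} {s} {r} c<r with bonus-cases c s r
... | inj₁ bonus≡0               = bonus≡0
... | inj₂ (inj₁ (_ , r<c , _)) = contradiction r<c (<-asym c<r)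
... | inj₂ (inj₂ (_ , r≡c , _)) = contradiction (sym r≡c) (<⇒≢ c<r)

bonus-≥9 : ∀ {c s r} → s ≤ r → r ≤ c → 9 ≤ bonus c s r
bonus-≥9 s≤r r≤c with m≤n⇒m<n∨m≡n r≤c
... | inj₁ r<c  = ≤-trans (m≤m+n 9 4) (≤-reflexive (sym (bonus-rung s≤r r<c)))
... | inj₂ refl = ≤-reflexive (sym (bonus-top s≤r))

shift : ℕ → ℕ → ℕ → ℕ
shift c s a with evenOdd a
... | even r = bonus c s r
... | odd  _ = 0

shift-double : ∀ c s r → shift c s (double r) ≡ bonus c s r
shift-double c s r rewrite evenOdd-double r = refl

shift-odd : ∀ c s r → shift c s (suc (double r)) ≡ 0
shift-odd c s r rewrite evenOdd-odd r = refl

shift-cases : ∀ c s a → shift c s a ≡ 0 ⊎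
                        (∃ λ r → a ≡ double r × s ≤ r × r < c × shift c s a ≡ 13) ⊎
                        (a ≡ double c × s ≤ c × shift c s a ≡ 9)
shift-cases c s a with evenOdd a
... | odd _ = inj₁ refl
... | even r with bonus-cases c s r
...   | inj₁ bonus≡0                       = inj₁ bonus≡0
...   | inj₂ (inj₁ (s≤r , r<c , bonus≡13)) = inj₂ (inj₁ (r , refl , s≤r , r<c , bonus≡13))
...   | inj₂ (inj₂ (s≤r , refl , bonus≡9)) = inj₂ (inj₂ (refl , s≤r , bonus≡9))

-- The s-th ordering sorts by key: since 13 + 4a = 1 + 4(a + 3) and 9 + 4a = 1 + 4(a + 2), the vertex
-- 2r (s ≤ r < c) lands just after 2r+3 and 2c (if s ≤ c) just after 2c+2.
key : ℕ → ℕ → ℕ → ℕ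
key c s a = shift c s a + double (double a)

key-gap : ∀ {c s a b} k → k + a ≤ b → shift c s a ≤ double (double k) → key c s a ≤ key c s b
key-gap {c} {s} {a} {b} k k+a≤b shift≤ = begin
  shift c s a + double (double a)        ≤⟨ +-monoˡ-≤ _ shift≤ ⟩
  double (double k) + double (double a)  ≡⟨ trans (cong double (double-+ k a)) (double-+ (double k) (double a)) ⟨
  double (double (k + a))                ≤⟨ double-mono-≤ (double-mono-≤ k+a≤b) ⟩
  double (double b)                      ≤⟨ m≤n+m _ _ ⟩
  key c s b                              ∎
  where open ≤-Reasoning

key-unshift-rung : ∀ {c s m} → s ≤ m → m < c → key c s (3 + double m) < key c s (double m)
key-unshift-rung {c} {s} {m} s≤m m<c = begin-strict
  key c s (3 + double m)                ≡⟨ cong (_+ _) (shift-odd c s (suc m)) ⟩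
  12 + double (double (double m))       <⟨ n<1+n _ ⟩
  13 + double (double (double m))       ≡⟨ cong (_+ _) (trans (shift-double c s m) (bonus-rung s≤m m<c)) ⟨
  key c s (double m)                    ∎
  where open ≤-Reasoning

key-unshift-top : ∀ {c s} → s ≤ c → key c s (2 + double c) < key c s (double c)
key-unshift-top {c} {s} s≤c = begin-strict
  key c s (2 + double c)                ≡⟨ cong (_+ _) (trans (shift-double c s (suc c)) (bonus-high ≤-refl)) ⟩
  8 + double (double (double c))        <⟨ n<1+n _ ⟩
  9 + double (double (double c))        ≡⟨ cong (_+ _) (trans (shift-double c s c) (bonus-top s≤c)) ⟨
  key c s (double c)                    ∎
  where open ≤-Reasoning

key-shifted-before-next : ∀ {c s r} → s ≤ r → r < c → key c s (double r) < key c s (2 + double r)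
key-shifted-before-next {c} {s} {r} s≤r r<c = begin-strict
  key c s (double r)                    ≡⟨ cong (_+ _) (trans (shift-double c s r) (bonus-rung s≤r r<c)) ⟩
  13 + double (double (double r))       <⟨ +-monoˡ-≤ _ (m≤m+n 14 3) ⟩
  9 + double (double (2 + double r))    ≤⟨ +-monoˡ-≤ _ (subst (9 ≤_) (sym (shift-double c s (suc r)))
                                                              (bonus-≥9 (m≤n⇒m≤1+n s≤r) r<c)) ⟩
  key c s (2 + double r)                ∎
  where open ≤-Reasoning

inversion-forward : ∀ {c s a b} → a < b → ¬ Reversed c b a → key c s b < key c s a →
                    ∃ λ r → s ≤ r × r ≤ c × a ≡ double r × b ≡ suc a
inversion-forward {c} {s} {a} a<b ¬rev kb<ka with shift-cases c s a
... | inj₁ shift≡0 = contradiction (key-gap 0 (<⇒≤ a<b) (≤-reflexive shift≡0)) (<⇒≱ kb<ka)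
... | inj₂ (inj₂ (refl , s≤c , shift≡9)) with m≤n⇒m<n∨m≡n a<b
...   | inj₂ refl = c , s≤c , ≤-refl , refl , refl
...   | inj₁ 2+a≤b with m≤n⇒m<n∨m≡n 2+a≤b
...     | inj₂ refl  = contradiction (top₁ refl refl) ¬rev
...     | inj₁ 3+a≤b = contradiction (key-gap 3 3+a≤b (≤-trans (≤-reflexive shift≡9) (m≤m+n 9 3))) (<⇒≱ kb<ka)
inversion-forward {c} {s} a<b ¬rev kb<ka | inj₂ (inj₁ (r , refl , s≤r , r<c , shift≡13)) with m≤n⇒m<n∨m≡n a<b
...   | inj₂ refl = r , s≤r , <⇒≤ r<c , refl , refl
...   | inj₁ 2+a≤b with m≤n⇒m<n∨m≡n 2+a≤b
...     | inj₂ refl = contradiction (key-shifted-before-next s≤r r<c) (<-asym kb<ka)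
...     | inj₁ 3+a≤b with m≤n⇒m<n∨m≡n 3+a≤b
...       | inj₂ refl  = contradiction (rung r r<c refl refl) ¬rev
...       | inj₁ 4+a≤b = contradiction (key-gap 4 4+a≤b (≤-trans (≤-reflexive shift≡13) (m≤m+n 13 3))) (<⇒≱ kb<ka)

equal-keys : ∀ {c s a b x y} → key c s a ≡ key c s b → shift c s a ≡ x → shift c s b ≡ y →
             x + double (double a) ≡ y + double (double b)
equal-keys eq sa sb = trans (cong (_+ _) (sym sa)) (trans eq (cong (_+ _) sb))

key-injective : ∀ c s → Injective _≡_ _≡_ (key c s)
key-injective c s {a} {b} eq with shift-cases c s a | shift-cases c s b
... | inj₁ sa | inj₁ sb = double-injective (double-injective (equal-keys eq sa sb))
... | inj₁ sa | inj₂ (inj₁ (r , refl , _ , _ , sb)) = ⊥-elim (double≢odd (double a) (6 + double (double r)) (equal-keys eq sa sb))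
... | inj₁ sa | inj₂ (inj₂ (refl , _ , sb))         = ⊥-elim (double≢odd (double a) (4 + double (double c)) (equal-keys eq sa sb))
... | inj₂ (inj₁ (r , refl , _ , _ , sa)) | inj₁ sb =
  ⊥-elim (double≢odd (double b) (6 + double (double r)) (sym (equal-keys eq sa sb)))
... | inj₂ (inj₂ (refl , _ , sa))         | inj₁ sb =
  ⊥-elim (double≢odd (double b) (4 + double (double c)) (sym (equal-keys eq sa sb)))
... | inj₂ (inj₁ (r , refl , _ , _ , sa)) | inj₂ (inj₁ (r′ , refl , _ , _ , sb)) =
  cong double (double-injective (double-injective (double-injective (+-cancelˡ-≡ 13 _ _ (equal-keys eq sa sb)))))
... | inj₂ (inj₂ (refl , _ , _)) | inj₂ (inj₂ (refl , _ , _)) = refl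
... | inj₂ (inj₁ (r , refl , _ , _ , sa)) | inj₂ (inj₂ (refl , _ , sb)) =
  ⊥-elim (double≢odd c r (double-injective (double-injective (+-cancelˡ-≡ 9 _ _ (equal-keys (sym eq) sb sa)))))
... | inj₂ (inj₂ (refl , _ , sa)) | inj₂ (inj₁ (r , refl , _ , _ , sb)) =
  ⊥-elim (double≢odd c r (double-injective (double-injective (+-cancelˡ-≡ 9 _ _ (equal-keys eq sa sb)))))

-- The possible shapes of an arc a → b of tournament c that points backwards in the s-th ordering.
data Inverted (c s a b : ℕ) : Set where
  rung    : ∀ m → m < c → m < s → a ≡ 3 + double m → b ≡ double m → Inverted c s a b
  top₁    : c < s → a ≡ 2 + double c → b ≡ double c → Inverted c s a b
  top₂    : a ≡ 4 + double c → b ≡ 2 + double c → Inverted c s a b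
  long    : a ≡ 3 + double c → b ≡ 1 → Inverted c s a b
  shifted : ∀ r → s ≤ r → r ≤ c → a ≡ double r → b ≡ suc (double r) → Inverted c s a b

inverted : ∀ {c s a b} → Arc (Reversed c) a b → key c s b < key c s a → Inverted c s a b
inverted (inj₁ (a<b , ¬rev)) kb<ka with inversion-forward a<b ¬rev kb<ka
... | r , s≤r , r≤c , refl , refl = shifted r s≤r r≤c refl refl
inverted {c} {s} (inj₂ (_ , rung m m<c refl refl)) kb<ka with m <? s
... | yes m<s = rung m m<c m<s refl refl
... | no  m≮s = contradiction (key-unshift-rung (≮⇒≥ m≮s) m<c) (<-asym kb<ka)
inverted {c} {s} (inj₂ (_ , top₁ refl refl)) kb<ka with c <? s
... | yes c<s = top₁ c<s refl refl
... | no  c≮s = contradiction (key-unshift-top (≮⇒≥ c≮s)) (<-asym kb<ka)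
inverted (inj₂ (_ , top₂ refl refl)) _ = top₂ refl refl
inverted (inj₂ (_ , long refl refl)) _ = long refl refl

Inverted-functional : ∀ {c s a b b′} → Inverted c s a b → Inverted c s a b′ → b ≡ b′
Inverted-functional (rung _ _ _ p q) (rung _ _ _ p′ q′) = trans q (trans (cong double (suc-injective (odd-injective p p′))) (sym q′))
Inverted-functional (rung _ _ _ p _) (top₁ _ p′ _)        = ⊥-elim (odd-even p p′)
Inverted-functional (rung _ _ _ p _) (top₂ p′ _)          = ⊥-elim (odd-even p p′)
Inverted-functional (rung _ m<c _ p _) (long p′ _)        = ⊥-elim (<-irrefl (suc-injective (odd-injective p p′)) m<c)
Inverted-functional (rung _ _ _ p _) (shifted _ _ _ p′ _) = ⊥-elim (odd-even p p′)
Inverted-functional (top₁ _ p _) (rung _ _ _ p′ _)        = ⊥-elim (even-odd p p′)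
Inverted-functional (top₁ _ _ q) (top₁ _ _ q′)            = trans q (sym q′)
Inverted-functional (top₁ _ p _) (top₂ p′ _)              = ⊥-elim (1+n≢n (sym (suc-injective (even-injective p p′))))
Inverted-functional (top₁ _ p _) (long p′ _)              = ⊥-elim (even-odd p p′)
Inverted-functional (top₁ _ p _) (shifted _ _ r≤c p′ _)   = ⊥-elim (1+n≰n (subst (_≤ _) (sym (even-injective p p′)) r≤c))
Inverted-functional (top₂ p _) (rung _ _ _ p′ _)          = ⊥-elim (even-odd p p′)
Inverted-functional (top₂ p _) (top₁ _ p′ _)              = ⊥-elim (1+n≢n (suc-injective (even-injective p p′)))
Inverted-functional (top₂ _ q) (top₂ _ q′)                = trans q (sym q′)
Inverted-functional (top₂ p _) (long p′ _)                = ⊥-elim (even-odd p p′)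
Inverted-functional (top₂ p _) (shifted _ _ r≤c p′ _) =
  ⊥-elim (1+n≰n (≤-trans (n≤1+n _) (subst (_≤ _) (sym (even-injective p p′)) r≤c)))
Inverted-functional (long p _) (rung _ m<c _ p′ _)        = ⊥-elim (<-irrefl (suc-injective (odd-injective p′ p)) m<c)
Inverted-functional (long p _) (top₁ _ p′ _)              = ⊥-elim (odd-even p p′)
Inverted-functional (long p _) (top₂ p′ _)                = ⊥-elim (odd-even p p′)
Inverted-functional (long _ q) (long _ q′)                = trans q (sym q′)
Inverted-functional (long p _) (shifted _ _ _ p′ _)       = ⊥-elim (odd-even p p′)
Inverted-functional (shifted _ _ _ p _) (rung _ _ _ p′ _) = ⊥-elim (even-odd p p′)
Inverted-functional (shifted _ _ r≤c p _) (top₁ _ p′ _)   = ⊥-elim (1+n≰n (subst (_≤ _) (even-injective p p′) r≤c))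
Inverted-functional (shifted _ _ r≤c p _) (top₂ p′ _)     = ⊥-elim (1+n≰n (≤-trans (n≤1+n _) (subst (_≤ _) (even-injective p p′) r≤c)))
Inverted-functional (shifted _ _ _ p _) (long p′ _)       = ⊥-elim (even-odd p p′)
Inverted-functional (shifted _ _ _ p q) (shifted _ _ _ p′ q′) = trans q (trans (cong (suc ∘ double) (even-injective p p′)) (sym q′))

-- The pairs Inverted c s overlap only along one path of length two; Conflict c s d says that d lies on it.
data Conflict (c : ℕ) : ℕ → ℕ → Set where
  at-long : ∀ {d} → d ≡ 0 ⊎ d ≡ 1 ⊎ d ≡ 3 + double c → Conflict c 0 d
  at-rung : ∀ {m d} → m < c → d ≡ double m ⊎ d ≡ 2 + double m ⊎ d ≡ 3 + double m → Conflict c (suc m) d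
  at-top  : ∀ {d} → d ≡ double c ⊎ d ≡ 2 + double c ⊎ d ≡ 4 + double c → Conflict c (suc c) d

off-path : ∀ {d x y z a b e : ℕ} → d ≡ x ⊎ d ≡ y ⊎ d ≡ z → a ≢ d → b ≢ d → e ≢ d → a ≡ x → b ≡ y → e ≡ z → ⊥
off-path (inj₁ refl)        a≢d _   _   a≡x _   _   = a≢d a≡x
off-path (inj₂ (inj₁ refl)) _   b≢d _   _   b≡y _   = b≢d b≡y
off-path (inj₂ (inj₂ refl)) _   _   e≢d _   _   e≡z = e≢d e≡z

long-meets-shifted : ∀ {c s d a a′ b r} → Conflict c s d → a ≢ d → a′ ≢ d → b ≢ d →
                     a ≡ 3 + double c → b ≡ 1 → s ≤ r → a′ ≡ double r → b ≡ suc (double r) → ⊥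
long-meets-shifted (at-long path) a≢d a′≢d b≢d p q _ p′ q′ =
  off-path path a′≢d b≢d a≢d (trans p′ (cong double (sym (odd-injective q q′)))) q p
long-meets-shifted (at-rung _ _) _ _ _ _ q s≤r _ q′ = contradiction (subst (_ ≤_) (sym (odd-injective q q′)) s≤r) λ ()
long-meets-shifted (at-top _)    _ _ _ _ q s≤r _ q′ = contradiction (subst (_ ≤_) (sym (odd-injective q q′)) s≤r) λ ()

Inverted-injective : ∀ {c s d a a′ b} → Conflict c s d → a ≢ d → a′ ≢ d → b ≢ d →
                     Inverted c s a b → Inverted c s a′ b → a ≡ a′
Inverted-injective _ _ _ _ (rung _ _ _ p q) (rung _ _ _ p′ q′) =
  trans p (trans (cong (λ m → 3 + double m) (even-injective q q′)) (sym p′))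
Inverted-injective _ _ _ _ (rung _ m<c _ _ q) (top₁ _ _ q′)        = ⊥-elim (<-irrefl (even-injective q q′) m<c)
Inverted-injective _ _ _ _ (rung _ m<c _ _ q) (top₂ _ q′) =
  ⊥-elim (<-asym m<c (subst (_ <_) (sym (even-injective q q′)) ≤-refl))
Inverted-injective _ _ _ _ (rung _ _ _ _ q) (long _ q′)            = ⊥-elim (even-odd q q′)
Inverted-injective _ _ _ _ (rung _ _ _ _ q) (shifted _ _ _ _ q′)   = ⊥-elim (even-odd q q′)
Inverted-injective _ _ _ _ (top₁ _ _ q) (rung _ m<c _ _ q′)        = ⊥-elim (<-irrefl (even-injective q′ q) m<c)
Inverted-injective _ _ _ _ (top₁ _ p _) (top₁ _ p′ _)              = trans p (sym p′)
Inverted-injective _ _ _ _ (top₁ _ _ q) (top₂ _ q′)                = ⊥-elim (1+n≢n (sym (even-injective q q′)))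
Inverted-injective _ _ _ _ (top₁ _ _ q) (long _ q′)                = ⊥-elim (even-odd q q′)
Inverted-injective _ _ _ _ (top₁ _ _ q) (shifted _ _ _ _ q′)       = ⊥-elim (even-odd q q′)
Inverted-injective _ _ _ _ (top₂ _ q) (rung _ m<c _ _ q′) =
  ⊥-elim (<-asym m<c (subst (_ <_) (sym (even-injective q′ q)) ≤-refl))
Inverted-injective _ _ _ _ (top₂ _ q) (top₁ _ _ q′)                = ⊥-elim (1+n≢n (even-injective q q′))
Inverted-injective _ _ _ _ (top₂ p _) (top₂ p′ _)                  = trans p (sym p′)
Inverted-injective _ _ _ _ (top₂ _ q) (long _ q′)                  = ⊥-elim (even-odd q q′)
Inverted-injective _ _ _ _ (top₂ _ q) (shifted _ _ _ _ q′)         = ⊥-elim (even-odd q q′)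
Inverted-injective _ _ _ _ (long _ q) (rung _ _ _ _ q′)            = ⊥-elim (odd-even q q′)
Inverted-injective _ _ _ _ (long _ q) (top₁ _ _ q′)                = ⊥-elim (odd-even q q′)
Inverted-injective _ _ _ _ (long _ q) (top₂ _ q′)                  = ⊥-elim (odd-even q q′)
Inverted-injective _ _ _ _ (long p _) (long p′ _)                  = trans p (sym p′)
Inverted-injective conflict a≢d a′≢d b≢d (long p q) (shifted r s≤r _ p′ q′) =
  ⊥-elim (long-meets-shifted conflict a≢d a′≢d b≢d p q s≤r p′ q′)
Inverted-injective _ _ _ _ (shifted _ _ _ _ q) (rung _ _ _ _ q′)   = ⊥-elim (odd-even q q′)
Inverted-injective _ _ _ _ (shifted _ _ _ _ q) (top₁ _ _ q′)       = ⊥-elim (odd-even q q′)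
Inverted-injective _ _ _ _ (shifted _ _ _ _ q) (top₂ _ q′)         = ⊥-elim (odd-even q q′)
Inverted-injective conflict a≢d a′≢d b≢d (shifted r s≤r _ p q) (long p′ q′) =
  ⊥-elim (long-meets-shifted conflict a′≢d a≢d b≢d p′ q′ s≤r p q)
Inverted-injective _ _ _ _ (shifted _ _ _ p q) (shifted _ _ _ p′ q′) = trans p (trans (cong double (odd-injective q q′)) (sym p′))

top-meets-top : ∀ {c s d a b e} → Conflict c s d → a ≢ d → b ≢ d → e ≢ d → c < s →
                a ≡ 4 + double c → b ≡ 2 + double c → e ≡ double c → ⊥
top-meets-top (at-rung m<c _) _ _ _ c<s _ _ _ = <⇒≱ m<c (s≤s⁻¹ c<s)
top-meets-top (at-top path) a≢d b≢d e≢d _ p q r = off-path path e≢d b≢d a≢d r q p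

shifted-meets-rung : ∀ {c s d a b e r m} → Conflict c s d → a ≢ d → b ≢ d → e ≢ d →
                     m < c → m < s → s ≤ r → r ≡ suc m →
                     a ≡ double r → b ≡ 3 + double m → e ≡ double m → ⊥
shifted-meets-rung (at-rung {m₀} _ path) a≢d b≢d e≢d _ m<s s≤r refl p q r
  with ≤-antisym (s≤s⁻¹ m<s) (s≤s⁻¹ s≤r)
... | refl = off-path path e≢d a≢d b≢d r p q
shifted-meets-rung (at-top _) _ _ _ m<c _ s≤r refl _ _ _ = <⇒≱ m<c (s≤s⁻¹ s≤r)

Inverted-no-path : ∀ {c s d a b e} → Conflict c s d → a ≢ d → b ≢ d → e ≢ d →
                   Inverted c s a b → Inverted c s b e → ⊥
Inverted-no-path _ _ _ _ (rung _ _ _ _ q) (rung _ _ _ p′ _)         = even-odd q p′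
Inverted-no-path {c} _ _ _ _ (rung _ m<c _ _ q) (top₁ _ p′ _)      = <⇒≱ m<c (subst (c ≤_) (sym (even-injective q p′)) (n≤1+n c))
Inverted-no-path {c} _ _ _ _ (rung _ m<c _ _ q) (top₂ p′ _)        = <⇒≱ m<c (subst (c ≤_) (sym (even-injective q p′)) (m≤n+m c 2))
Inverted-no-path _ _ _ _ (rung _ _ _ _ q) (long p′ _)               = even-odd q p′
Inverted-no-path {s = s} _ _ _ _ (rung _ _ m<s _ q) (shifted _ s≤r _ p′ _) = <⇒≱ m<s (subst (s ≤_) (sym (even-injective q p′)) s≤r)
Inverted-no-path _ _ _ _ (top₁ _ _ q) (rung _ _ _ p′ _)             = even-odd q p′
Inverted-no-path _ _ _ _ (top₁ _ _ q) (top₁ _ p′ _)                 = 1+n≢n (sym (even-injective q p′))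
Inverted-no-path {c} _ _ _ _ (top₁ _ _ q) (top₂ p′ _)               = m≢1+n+m c {1} (even-injective q p′)
Inverted-no-path _ _ _ _ (top₁ _ _ q) (long p′ _)                   = even-odd q p′
Inverted-no-path {s = s} _ _ _ _ (top₁ c<s _ q) (shifted _ s≤r _ p′ _) = <⇒≱ c<s (subst (s ≤_) (sym (even-injective q p′)) s≤r)
Inverted-no-path _ _ _ _ (top₂ _ q) (rung _ _ _ p′ _)               = even-odd q p′
Inverted-no-path conflict a≢d b≢d e≢d (top₂ p q) (top₁ c<s p′ q′) = top-meets-top conflict a≢d b≢d e≢d c<s p q q′
Inverted-no-path _ _ _ _ (top₂ _ q) (top₂ p′ _)                     = 1+n≢n (sym (suc-injective (even-injective q p′)))
Inverted-no-path _ _ _ _ (top₂ _ q) (long p′ _)                     = even-odd q p′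
Inverted-no-path _ _ _ _ (top₂ _ q) (shifted _ _ r≤c p′ _)          = 1+n≰n (subst (_≤ _) (sym (even-injective q p′)) r≤c)
Inverted-no-path _ _ _ _ (long _ q) (rung _ _ _ p′ _)               = contradiction (odd-injective q p′) λ ()
Inverted-no-path _ _ _ _ (long _ q) (top₁ _ p′ _)                   = odd-even q p′
Inverted-no-path _ _ _ _ (long _ q) (top₂ p′ _)                     = odd-even q p′
Inverted-no-path _ _ _ _ (long _ q) (long p′ _)                     = contradiction (odd-injective q p′) λ ()
Inverted-no-path _ _ _ _ (long _ q) (shifted _ _ _ p′ _)            = odd-even q p′
Inverted-no-path conflict a≢d b≢d e≢d (shifted _ s≤r _ p q) (rung _ m<c m<s p′ q′) =
  shifted-meets-rung conflict a≢d b≢d e≢d m<c m<s s≤r (odd-injective q p′) p p′ q′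
Inverted-no-path _ _ _ _ (shifted _ _ _ _ q) (top₁ _ p′ _)          = odd-even q p′
Inverted-no-path _ _ _ _ (shifted _ _ _ _ q) (top₂ p′ _)            = odd-even q p′
Inverted-no-path _ _ _ _ (shifted _ _ r≤c _ q) (long p′ _)          = 1+n≰n (subst (_≤ _) (odd-injective q p′) r≤c)
Inverted-no-path _ _ _ _ (shifted _ _ _ _ q) (shifted _ _ _ p′ _)   = odd-even q p′

Inverted-matching : ∀ {c s d} → Conflict c s d → IsMatching (λ a b → Inverted c s a b × a ≢ d × b ≢ d)
Inverted-matching conflict (i , _ , _) (i′ , _ , _) (inj₁ refl) (inj₁ refl) = refl , Inverted-functional i i′
Inverted-matching conflict (i , a≢d , b≢d) (i′ , a′≢d , _) (inj₁ refl) (inj₂ refl) =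
  ⊥-elim (Inverted-no-path conflict a′≢d a≢d b≢d i′ i)
Inverted-matching conflict (i , a≢d , b≢d) (i′ , _ , b′≢d) (inj₂ refl) (inj₁ refl) =
  ⊥-elim (Inverted-no-path conflict a≢d b≢d b′≢d i i′)
Inverted-matching conflict (i , a≢d , b≢d) (i′ , a′≢d , _) (inj₂ refl) (inj₂ refl) =
  Inverted-injective conflict a≢d a′≢d b≢d i i′ , refl

conflict-through : ∀ c d → d < order c → ∃ λ s → Conflict c s d
conflict-through c d d<n with evenOdd d
... | even zero = 0 , at-long (inj₁ refl)
... | odd  zero = 0 , at-long (inj₂ (inj₁ refl))
... | even (suc m) with m≤n⇒m<n∨m≡n (s≤s⁻¹ (double≤1+double⇒≤ (m≤n⇒m≤1+n (s≤s⁻¹ d<n))))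
...   | inj₂ refl = suc c , at-top (inj₂ (inj₂ refl))
...   | inj₁ m<1+c with m≤n⇒m<n∨m≡n (s≤s⁻¹ m<1+c)
...     | inj₁ m<c  = suc m , at-rung m<c (inj₂ (inj₁ refl))
...     | inj₂ refl = suc c , at-top (inj₂ (inj₁ refl))
conflict-through c d d<n | odd (suc m) with m≤n⇒m<n∨m≡n (s≤s⁻¹ (double≤1+double⇒≤ (s≤s⁻¹ (s≤s⁻¹ d<n))))
...   | inj₁ m<c  = suc m , at-rung m<c (inj₂ (inj₂ refl))
...   | inj₂ refl = 0 , at-long (inj₂ (inj₂ refl))

tournament-minimal : ∀ c m (f : Fin m → Fin (order c)) (f-injective : Injective _≡_ _≡_ f) → m < order c →
                     MatchingTournament (induced (tournament c) f f-injective)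
tournament-minimal c m f f-injective m<n =
  σ , matchingOrdering-via {T = induced (tournament c) f f-injective} {σ = σ}
        A A-injective (Inverted-matching (proj₂ conflict)) backedge⇒inverted
  where
  missing : ∃ λ d → ∀ u → f u ≢ d
  missing = injective⇒missing f-injective m<n

  d : ℕ
  d = toℕ (proj₁ missing)

  A : Fin m → ℕ
  A = toℕ ∘ f

  A-injective : Injective _≡_ _≡_ A
  A-injective = f-injective ∘ Finₚ.toℕ-injective

  A≢d : ∀ u → A u ≢ d
  A≢d u = proj₂ missing u ∘ Finₚ.toℕ-injective

  conflict : ∃ λ s → Conflict c s d
  conflict = conflict-through c d (Finₚ.toℕ<n (proj₁ missing))

  s : ℕ
  s = proj₁ conflict

  ordered : Σ (Ordering m) λ σ → ∀ u v → pos σ v Fin.< pos σ u → key c s (A v) < key c s (A u)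
  ordered = orderingBy (key c s ∘ A) (A-injective ∘ key-injective c s)

  σ : Ordering m
  σ = proj₁ ordered

  backedge⇒inverted : ∀ {u v} → Backedge (induced (tournament c) f f-injective) σ u v →
                      Inverted c s (A u) (A v) × A u ≢ d × A v ≢ d
  backedge⇒inverted {u} {v} (arc , later) = inverted arc (proj₂ ordered u v later) , A≢d u , A≢d v

theorem5p9 : Σ (ℕ → SomeTournament) λ F →
    (∀ i → MinimalNonMatching (proj₂ (F i))) ×
    (∀ i j → i ≢ j → ¬ Isomorphic (proj₂ (F i)) (proj₂ (F j)))
theorem5p9 =
  (λ i → order (suc i) , tournament (suc i)) ,
  (λ i → tournament-not-matching i , tournament-minimal (suc i)) ,
  λ i j i≢j (φ , _) → refute (i≢j ∘ suc-injective ∘ order-injective) φ
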